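{- Let $q$ be a prime power, $m,\ell$ positive integers, and let $W$ be an $\mathbb{F}_q$-subspace of $\mathbb{F}_{q^m}^2$ with $\dim_{\mathbb{F}_q}W=2\ell$. Assume there exist $\mathbf y_1,\mathbf y_2,\mathbf y_3\in W$, no two of which are $\mathbb{F}_{q^m}$-proportional, such that $\dim_{\mathbb{F}_q}(W\cap\langle\mathbf y_i\rangle_{\mathbb{F}_{q^m}})=\ell$ for $i=1,2,3$. Then there exist an $\mathbb{F}_q$-subspace $S\subseteq\mathbb{F}_{q^m}$ with $\dim_{\mathbb{F}_q}S=\ell$ and a matrix $B\in\mathrm{GL}(2,q^m)$ such that $W\cdot B=\{\mathbf wB:\mathbf w\in W\}=S\times S$.
   Context: $\mathbb{F}_{q^m}$ is the degree-$m$ extension of $\mathbb{F}_q$; elements of $\mathbb{F}_{q^m}^2$ are row vectors. -}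

module Defs where

open import Level using (0ℓ)
open import Data.Nat using (ℕ; zero; suc; _^_; _≥_)
open import Data.Nat.Primality using (Prime)
open import Data.Fin using (Fin; zero; suc)
open import Data.Product using (Σ; ∃; _×_; _,_; proj₁; proj₂)
open import Data.Sum using (_⊎_)
open import Relation.Binary.PropositionalEquality using (_≡_)
open import Relation.Nullary using (¬_)
open import Algebra.Bundles using (CommutativeRing)

IsPrimePower : ℕ → Set
IsPrimePower q = Σ ℕ λ p → Σ ℕ λ k → Prime p × k ≥ 1 × q ≡ p ^ k

record Field : Set₁ where
  field
    commRing : CommutativeRing 0ℓ 0ℓ
  open CommutativeRing commRing public using (Carrier; _≈_; _+_; _*_; -_; 0#; 1#)
  field
    0≉1     : ¬ (0# ≈ 1#)
    inverse : ∀ x → ¬ (x ≈ 0#) → Σ Carrier λ y → (x * y) ≈ 1#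

module FieldTheory (F : Field) where
  open Field F public

  HasCard : ℕ → Set
  HasCard n = Σ (Fin n → Carrier) λ e →
    (∀ i j → e i ≈ e j → i ≡ j) × (∀ x → Σ (Fin n) λ i → e i ≈ x)

  HasCardSub : (Carrier → Set) → ℕ → Set
  HasCardSub P n = Σ (Fin n → Carrier) λ e →
    (∀ i → P (e i)) × (∀ i j → e i ≈ e j → i ≡ j) ×
    (∀ x → P x → Σ (Fin n) λ i → e i ≈ x)

  record IsSubfield (K : Carrier → Set) : Set where
    field
      resp  : ∀ {x y} → x ≈ y → K x → K y
      has0  : K 0#
      has1  : K 1#
      +-closed : ∀ {x y} → K x → K y → K (x + y)
      neg-closed : ∀ {x} → K x → K (- x)
      *-closed : ∀ {x y} → K x → K y → K (x * y)
      inv-closed : ∀ {x y} → K x → (x * y) ≈ 1# → K y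

  record VecStr : Set₁ where
    field
      V    : Set
      _≈v_ : V → V → Set
      0v   : V
      _+v_ : V → V → V
      _·v_ : Carrier → V → V

  module Lin (K : Carrier → Set) (VS : VecStr) where
    open VecStr VS

    ∑ : ∀ {d} → (Fin d → V) → V
    ∑ {zero}  f = 0v
    ∑ {suc d} f = f zero +v ∑ (λ i → f (suc i))

    lincomb : ∀ {d} → (Fin d → Carrier) → (Fin d → V) → V
    lincomb c v = ∑ (λ i → c i ·v v i)

    record IsKSubspace (U : V → Set) : Set where
      field
        resp : ∀ {x y} → x ≈v y → U x → U y
        has0 : U 0v
        +-closed : ∀ {x y} → U x → U y → U (x +v y)
        ·-closed : ∀ {a x} → K a → U x → U (a ·v x)

    HasDim : (V → Set) → ℕ → Set
    HasDim U d = Σ (Fin d → V) λ b →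
      (∀ i → U (b i)) ×
      (∀ (c : Fin d → Carrier) → (∀ i → K (c i)) →
         lincomb c b ≈v 0v → ∀ i → c i ≈ 0#) ×
      (∀ u → U u → Σ (Fin d → Carrier) λ c → (∀ i → K (c i)) × lincomb c b ≈v u)

  L¹ : VecStr
  L¹ = record { V = Carrier ; _≈v_ = _≈_ ; 0v = 0# ; _+v_ = _+_ ; _·v_ = _*_ }

  L2 : Set
  L2 = Carrier × Carrier

  _≈₂_ : L2 → L2 → Set
  (a , b) ≈₂ (c , d) = (a ≈ c) × (b ≈ d)

  _·₂_ : Carrier → L2 → L2
  λ' ·₂ (a , b) = (λ' * a , λ' * b)

  L² : VecStr
  L² = record { V = L2 ; _≈v_ = _≈₂_ ; 0v = (0# , 0#)
              ; _+v_ = λ u v → (proj₁ u + proj₁ v , proj₂ u + proj₂ v)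
              ; _·v_ = _·₂_ }

  ⟨_⟩ : L2 → L2 → Set
  ⟨ y ⟩ w = Σ Carrier λ λ' → w ≈₂ (λ' ·₂ y)

  Proportional : L2 → L2 → Set
  Proportional y z = (Σ Carrier λ λ' → z ≈₂ (λ' ·₂ y)) ⊎ (Σ Carrier λ λ' → y ≈₂ (λ' ·₂ z))

  record Mat2 : Set where
    constructor mat
    field
      a b c d : Carrier

  _⊗_ : Mat2 → Mat2 → Mat2
  mat a b c d ⊗ mat a' b' c' d' =
    mat (a * a' + b * c') (a * b' + b * d') (c * a' + d * c') (c * b' + d * d')

  I₂ : Mat2
  I₂ = mat 1# 0# 0# 1#

  _≈M_ : Mat2 → Mat2 → Set
  mat a b c d ≈M mat a' b' c' d' = (a ≈ a') × (b ≈ b') × (c ≈ c') × (d ≈ d')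

  InGL2 : Mat2 → Set
  InGL2 B = Σ Mat2 λ B' → ((B ⊗ B') ≈M I₂) × ((B' ⊗ B) ≈M I₂)

  _∙M_ : L2 → Mat2 → L2
  (x , y) ∙M mat a b c d = (x * a + y * c , x * b + y * d)

  ImageEq : (L2 → Set) → Mat2 → (Carrier → Set) → Set
  ImageEq W B S = ∀ z →
    ((Σ L2 λ w → W w × ((w ∙M B) ≈₂ z)) → (S (proj₁ z) × S (proj₂ z))) ×
    ((S (proj₁ z) × S (proj₂ z)) → Σ L2 λ w → W w × ((w ∙M B) ≈₂ z))

{-# OPTIONS --safe #-}
module Submission where

-- Write y₃ = a y₁ + b y₂; non-proportionality makes a, b ≠ 0. Let Z be the matrix with rows
-- g₁ = a y₁ and g₂ = b y₂, so that y₃ = g₁ + g₂, and B = Z⁻¹. For g ∈ L² put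
-- S_g = {x ∈ L | x g ∈ W}; then dim S_g = dim (W ∩ ⟨g⟩), so S_g₁, S_g₂ and S_{g₁+g₂} all have
-- dimension ℓ. Since dim W = 2ℓ, W = S_g₁ g₁ ⊕ S_g₂ g₂, i.e. W B = S_g₁ × S_g₂. Splitting
-- x (g₁ + g₂) = x g₁ + x g₂ gives S_{g₁+g₂} ⊆ S_g₁ ∩ S_g₂, and equality of dimensions then forces
-- S_g₁ = S_{g₁+g₂} = S_g₂.
--
-- Finiteness of L is used only to decide equality in L, which makes Gaussian elimination, and with
-- it the dimension theory of K-subspaces, constructive.

open import Defs
open import Data.Nat as ℕ using (ℕ; zero; suc; _^_; _≥_) renaming (_*_ to _*ℕ_)
open import Data.Product using (Σ; ∃; _×_; _,_; proj₁; proj₂)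
open import Relation.Nullary using (¬_; Dec; yes; no)

open import Level using (0ℓ)
open import Algebra.Bundles using (CommutativeRing; CommutativeMonoid)
import Algebra.Construct.DirectProduct as DirectProduct
open import Algebra.Solver.Ring.AlmostCommutativeRing
  using (fromCommutativeRing; _-Raw-AlmostCommutative⟶_)
open import Algebra.Structures using (IsCommutativeMonoid)
open import Data.Empty using (⊥-elim)
open import Data.Fin as Fin using (Fin; zero; suc; _↑ˡ_; _↑ʳ_; splitAt; punchIn; punchOut)
import Data.Fin.Properties as Fin
open import Data.Integer as ℤ using (ℤ; +_; -[1+_]; _⊖_; _◃_; sign; ∣_∣)
import Data.Integer.Properties as ℤ
open import Data.Maybe using (Maybe; just; nothing)
import Data.Nat.Properties as ℕ
open import Data.Sign as Sign using (Sign)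
open import Data.Sum using (inj₁; inj₂)
open import Data.Vec.Functional using (_∷_; _++_)
open import Data.Vec.Functional.Properties using (lookup-++ˡ; lookup-++ʳ)
open import Relation.Binary using (Decidable)
open import Relation.Binary.PropositionalEquality as ≡ using (_≡_)
import Relation.Binary.Reasoning.Setoid
open import Relation.Unary using (_⊆_; _∩_)

↑-elim : ∀ {m n} (P : Fin (m ℕ.+ n) → Set) → (∀ i → P (i ↑ˡ n)) → (∀ j → P (m ↑ʳ j)) → ∀ k → P k
↑-elim {m} P left right k with splitAt m k in eq
... | inj₁ i = ≡.subst P (Fin.splitAt⁻¹-↑ˡ eq) (left i)
... | inj₂ j = ≡.subst P (Fin.splitAt⁻¹-↑ʳ eq) (right j)

-- The ring solver with coefficients in ℤ, whose arithmetic normalises by computation: with the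
-- ring itself as coefficient ring, normal forms would contain unevaluated terms such as 1# * 1#.
module IntegerCoefficientSolver {c ℓ} (R : CommutativeRing c ℓ) where
  open CommutativeRing R
  open import Algebra.Properties.Ring ring using (-1*x≈-x; -‿involutive; -‿+-comm; -0#≈0#)
  open import Algebra.Properties.Semiring.Mult.TCOptimised semiring using (1+×; ×-homo-+; ×1-homo-*)
    renaming (_×_ to _×ᵣ_)
  open import Algebra.Properties.CommutativeSemigroup *-commutativeSemigroup using (interchange)
  open import Algebra.Properties.CommutativeSemigroup +-commutativeSemigroup
    using () renaming (interchange to +-interchange)
  open import Relation.Binary.Reasoning.Setoid setoid

  ⟦_⟧ : ℤ → Carrier
  ⟦ + n ⟧      = n ×ᵣ 1#
  ⟦ -[1+ n ] ⟧ = - (suc n ×ᵣ 1#)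

  sgn : Sign → Carrier
  sgn Sign.+ = 1#
  sgn Sign.- = - 1#

  sgn-homo : ∀ s t → sgn (s Sign.* t) ≈ sgn s * sgn t
  sgn-homo Sign.+ t      = sym (*-identityˡ _)
  sgn-homo Sign.- Sign.+ = sym (*-identityʳ _)
  sgn-homo Sign.- Sign.- = sym (trans (-1*x≈-x (- 1#)) (-‿involutive 1#))

  ◃-homo : ∀ s n → ⟦ s ◃ n ⟧ ≈ sgn s * (n ×ᵣ 1#)
  ◃-homo s      zero    = sym (zeroʳ _)
  ◃-homo Sign.+ (suc n) = sym (*-identityˡ _)
  ◃-homo Sign.- (suc n) = sym (-1*x≈-x _)

  sign-abs : ∀ i → ⟦ i ⟧ ≈ sgn (sign i) * (∣ i ∣ ×ᵣ 1#)
  sign-abs i = trans (reflexive (≡.cong ⟦_⟧ (≡.sym (ℤ.◃-inverse i)))) (◃-homo (sign i) ∣ i ∣)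

  *-homo : ∀ i j → ⟦ i ℤ.* j ⟧ ≈ ⟦ i ⟧ * ⟦ j ⟧
  *-homo i j = begin
    ⟦ (sign i Sign.* sign j) ◃ (∣ i ∣ ℕ.* ∣ j ∣) ⟧                ≈⟨ ◃-homo _ (∣ i ∣ ℕ.* ∣ j ∣) ⟩
    sgn (sign i Sign.* sign j) * ((∣ i ∣ ℕ.* ∣ j ∣) ×ᵣ 1#)
      ≈⟨ *-cong (sgn-homo (sign i) (sign j)) (×1-homo-* ∣ i ∣ ∣ j ∣) ⟩
    (sgn (sign i) * sgn (sign j)) * (∣ i ∣ ×ᵣ 1# * ∣ j ∣ ×ᵣ 1#)   ≈⟨ interchange _ _ _ _ ⟩
    (sgn (sign i) * ∣ i ∣ ×ᵣ 1#) * (sgn (sign j) * ∣ j ∣ ×ᵣ 1#)   ≈⟨ *-cong (sign-abs i) (sign-abs j) ⟨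
    ⟦ i ⟧ * ⟦ j ⟧                                                ∎

  -‿homo : ∀ i → ⟦ ℤ.- i ⟧ ≈ - ⟦ i ⟧
  -‿homo (+ zero)  = sym -0#≈0#
  -‿homo (+ suc n) = refl
  -‿homo -[1+ n ]  = sym (-‿involutive _)

  ⊖-homo : ∀ m n → ⟦ m ⊖ n ⟧ ≈ m ×ᵣ 1# + - (n ×ᵣ 1#)
  ⊖-homo m       zero    = sym (trans (+-congˡ -0#≈0#) (+-identityʳ _))
  ⊖-homo zero    (suc n) = sym (+-identityˡ _)
  ⊖-homo (suc m) (suc n) = begin
    ⟦ suc m ⊖ suc n ⟧                ≡⟨ ≡.cong ⟦_⟧ (ℤ.[1+m]⊖[1+n]≡m⊖n m n) ⟩
    ⟦ m ⊖ n ⟧                        ≈⟨ ⊖-homo m n ⟩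
    a + - b                          ≈⟨ +-identityˡ _ ⟨
    0# + (a + - b)                   ≈⟨ +-congʳ (-‿inverseʳ 1#) ⟨
    (1# + - 1#) + (a + - b)          ≈⟨ +-interchange _ _ _ _ ⟩
    (1# + a) + (- 1# + - b)          ≈⟨ +-congˡ (-‿+-comm 1# b) ⟩
    (1# + a) + - (1# + b)            ≈⟨ +-cong (1+× m 1#) (-‿cong (1+× n 1#)) ⟨
    suc m ×ᵣ 1# + - (suc n ×ᵣ 1#)    ∎
    where
    a = m ×ᵣ 1#
    b = n ×ᵣ 1#

  +-homo : ∀ i j → ⟦ i ℤ.+ j ⟧ ≈ ⟦ i ⟧ + ⟦ j ⟧
  +-homo (+ m)    (+ n)    = ×-homo-+ 1# m n
  +-homo (+ m)    -[1+ n ] = ⊖-homo m (suc n)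
  +-homo -[1+ m ] (+ n)    = trans (⊖-homo n (suc m)) (+-comm _ _)
  +-homo -[1+ m ] -[1+ n ] = begin
    - (suc (suc m ℕ.+ n) ×ᵣ 1#)         ≡⟨ ≡.cong (λ k → - (suc k ×ᵣ 1#)) (ℕ.+-suc m n) ⟨
    - ((suc m ℕ.+ suc n) ×ᵣ 1#)         ≈⟨ -‿cong (×-homo-+ 1# (suc m) (suc n)) ⟩
    - (suc m ×ᵣ 1# + suc n ×ᵣ 1#)        ≈⟨ -‿+-comm _ _ ⟨
    - (suc m ×ᵣ 1#) + - (suc n ×ᵣ 1#)    ∎

  homomorphism : ℤ.+-*-rawRing -Raw-AlmostCommutative⟶ fromCommutativeRing R
  homomorphism = record
    { ⟦_⟧ = ⟦_⟧ ; +-homo = +-homo ; *-homo = *-homo ; -‿homo = -‿homo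
    ; 0-homo = refl ; 1-homo = refl }

  equal? : ∀ i j → Maybe (⟦ i ⟧ ≈ ⟦ j ⟧)
  equal? i j with i ℤ.≟ j
  ... | yes ≡.refl = just refl
  ... | no _       = nothing

  open import Algebra.Solver.Ring ℤ.+-*-rawRing (fromCommutativeRing R) homomorphism equal? public
    using (solve; _:=_; _:+_; _:*_; :-_; con)

module _ (F : Field) where
  open FieldTheory F
  open CommutativeRing commRing
    using ( setoid; refl; sym; trans; +-cong; +-congˡ; +-congʳ; *-cong; *-congˡ; *-congʳ
          ; +-identityˡ; *-identityˡ; *-comm; *-assoc; zeroˡ; zeroʳ; distribˡ; distribʳ
          ; -‿cong; -‿inverseʳ; +-isCommutativeMonoid; +-commutativeMonoid )
  open IntegerCoefficientSolver commRing

  module ≈-Reasoning = Relation.Binary.Reasoning.Setoid setoid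

  finite⇒decidable : ∀ {n} → HasCard n → Decidable _≈_
  finite⇒decidable (e , e-injective , e-surjective) x y with e-surjective x | e-surjective y
  ... | i , eᵢ≈x | j , eⱼ≈y with i Fin.≟ j
  ...   | yes ≡.refl = yes (trans (sym eᵢ≈x) eⱼ≈y)
  ...   | no i≢j     = no (λ x≈y → i≢j (e-injective i j (trans eᵢ≈x (trans x≈y (sym eⱼ≈y)))))

  inverse-cancelˡ : ∀ {a a⁻¹} → a * a⁻¹ ≈ 1# → ∀ b → a⁻¹ * (a * b) ≈ b
  inverse-cancelˡ {a} {a⁻¹} aa⁻¹≈1 b = begin
    a⁻¹ * (a * b)   ≈⟨ solve 3 (λ a a⁻¹ b → a⁻¹ :* (a :* b) := (a :* a⁻¹) :* b) refl a a⁻¹ b ⟩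
    (a * a⁻¹) * b   ≈⟨ *-congʳ aa⁻¹≈1 ⟩
    1# * b          ≈⟨ *-identityˡ b ⟩
    b               ∎
    where open ≈-Reasoning

  *-nonzero : ∀ {a b} → ¬ a ≈ 0# → ¬ b ≈ 0# → ¬ a * b ≈ 0#
  *-nonzero {a} {b} a≉0 b≉0 ab≈0 with inverse a a≉0
  ... | a⁻¹ , aa⁻¹≈1 = b≉0 (begin
    b               ≈⟨ inverse-cancelˡ aa⁻¹≈1 b ⟨
    a⁻¹ * (a * b)   ≈⟨ *-congˡ ab≈0 ⟩
    a⁻¹ * 0#        ≈⟨ zeroʳ a⁻¹ ⟩
    0#              ∎)
    where open ≈-Reasoning

  record IsVectorStructure (VS : VecStr) : Set where
    open VecStr VS
    field
      +v-isCommutativeMonoid : IsCommutativeMonoid _≈v_ _+v_ 0v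
      ·-cong     : ∀ {a b x y} → a ≈ b → x ≈v y → (a ·v x) ≈v (b ·v y)
      ·-distribˡ : ∀ a x y → (a ·v (x +v y)) ≈v ((a ·v x) +v (a ·v y))
      ·-distribʳ : ∀ a b x → ((a + b) ·v x) ≈v ((a ·v x) +v (b ·v x))
      ·-assoc    : ∀ a b x → ((a * b) ·v x) ≈v (a ·v (b ·v x))
      ·-identity : ∀ x → (1# ·v x) ≈v x
      ·-zeroˡ    : ∀ x → (0# ·v x) ≈v 0v
      ·-zeroʳ    : ∀ a → (a ·v 0v) ≈v 0v

    +v-commutativeMonoid : CommutativeMonoid 0ℓ 0ℓ
    +v-commutativeMonoid = record { isCommutativeMonoid = +v-isCommutativeMonoid }

    open CommutativeMonoid +v-commutativeMonoid public
      using () renaming ( setoid to vsetoid; refl to vrefl; sym to vsym; trans to vtrans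
                        ; reflexive to vreflexive
                        ; ∙-cong to +v-cong; ∙-congˡ to +v-congˡ; ∙-congʳ to +v-congʳ
                        ; identityˡ to +v-identityˡ; identityʳ to +v-identityʳ
                        ; assoc to +v-assoc)

  L¹-isVectorStructure : IsVectorStructure L¹
  L¹-isVectorStructure = record
    { +v-isCommutativeMonoid = +-isCommutativeMonoid
    ; ·-cong = *-cong ; ·-distribˡ = distribˡ ; ·-distribʳ = λ a b x → distribʳ x a b
    ; ·-assoc = *-assoc ; ·-identity = *-identityˡ ; ·-zeroˡ = zeroˡ ; ·-zeroʳ = zeroʳ }

  L²-isVectorStructure : IsVectorStructure L²
  L²-isVectorStructure = record
    { +v-isCommutativeMonoid = CommutativeMonoid.isCommutativeMonoid
        (DirectProduct.commutativeMonoid +-commutativeMonoid +-commutativeMonoid)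
    ; ·-cong     = λ a≈b (x₁≈y₁ , x₂≈y₂) → *-cong a≈b x₁≈y₁ , *-cong a≈b x₂≈y₂
    ; ·-distribˡ = λ a x y → distribˡ a _ _ , distribˡ a _ _
    ; ·-distribʳ = λ a b x → distribʳ _ a b , distribʳ _ a b
    ; ·-assoc    = λ a b x → *-assoc a b _ , *-assoc a b _
    ; ·-identity = λ x → *-identityˡ _ , *-identityˡ _
    ; ·-zeroˡ    = λ x → zeroˡ _ , zeroˡ _
    ; ·-zeroʳ    = λ a → zeroʳ a , zeroʳ a }

  _+₂_ : L2 → L2 → L2
  _+₂_ = VecStr._+v_ L²

  open IsVectorStructure L²-isVectorStructure using ()
    renaming ( vrefl to ≈₂-refl; vsym to ≈₂-sym; vtrans to ≈₂-trans
             ; ·-cong to ·₂-cong; ·-assoc to ·₂-assoc; ·-distribˡ to ·₂-distribˡ; ·-distribʳ to ·₂-distribʳ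
             ; ·-identity to ·₂-identity; ·-zeroˡ to ·₂-zeroˡ
             ; +v-cong to +₂-cong; +v-congˡ to +₂-congˡ; +v-congʳ to +₂-congʳ
             ; +v-identityˡ to +₂-identityˡ; +v-identityʳ to +₂-identityʳ )

  module LinearCombinations (K : Carrier → Set) {VS : VecStr} (isVS : IsVectorStructure VS) where
    open VecStr VS
    open IsVectorStructure isVS
    open Lin K VS
    open import Algebra.Properties.CommutativeSemigroup
      (CommutativeMonoid.commutativeSemigroup +v-commutativeMonoid) using (interchange)
    private module L1 = Lin K L¹
    module ≈v-Reasoning = Relation.Binary.Reasoning.Setoid vsetoid

    ∑-cong : ∀ {d} {f g : Fin d → V} → (∀ i → f i ≈v g i) → ∑ f ≈v ∑ g
    ∑-cong {zero}  f≈g = vrefl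
    ∑-cong {suc d} f≈g = +v-cong (f≈g zero) (∑-cong (λ i → f≈g (suc i)))

    ∑-zero : ∀ {d} {f : Fin d → V} → (∀ i → f i ≈v 0v) → ∑ f ≈v 0v
    ∑-zero {zero}  f≈0 = vrefl
    ∑-zero {suc d} f≈0 = vtrans (+v-cong (f≈0 zero) (∑-zero (λ i → f≈0 (suc i)))) (+v-identityˡ 0v)

    ∑-distrib-+ : ∀ {d} (f g : Fin d → V) → ∑ (λ i → f i +v g i) ≈v (∑ f +v ∑ g)
    ∑-distrib-+ {zero}  f g = vsym (+v-identityˡ 0v)
    ∑-distrib-+ {suc d} f g =
      vtrans (+v-congˡ (∑-distrib-+ (λ i → f (suc i)) (λ i → g (suc i)))) (interchange _ _ _ _)

    ∑-comm : ∀ {m n} (f : Fin m → Fin n → V) → ∑ (λ j → ∑ (f j)) ≈v ∑ (λ k → ∑ (λ j → f j k))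
    ∑-comm {zero} {n} f = vsym (∑-zero {n} (λ _ → vrefl))
    ∑-comm {suc m} f = vtrans (+v-congˡ (∑-comm (λ j → f (suc j))))
                              (vsym (∑-distrib-+ (f zero) (λ k → ∑ (λ j → f (suc j) k))))

    ·-distrib-∑ : ∀ {d} a (f : Fin d → V) → (a ·v ∑ f) ≈v ∑ (λ i → a ·v f i)
    ·-distrib-∑ {zero}  a f = ·-zeroʳ a
    ·-distrib-∑ {suc d} a f = vtrans (·-distribˡ a _ _) (+v-congˡ (·-distrib-∑ a (λ i → f (suc i))))

    ∑-distrib-· : ∀ {d} (g : Fin d → Carrier) x → (L1.∑ g ·v x) ≈v ∑ (λ i → g i ·v x)
    ∑-distrib-· {zero}  g x = ·-zeroˡ x
    ∑-distrib-· {suc d} g x = vtrans (·-distribʳ _ _ x) (+v-congˡ (∑-distrib-· (λ i → g (suc i)) x))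

    ∑-↑ : ∀ m {n} (f : Fin (m ℕ.+ n) → V) → ∑ f ≈v (∑ (λ i → f (i ↑ˡ n)) +v ∑ (λ j → f (m ↑ʳ j)))
    ∑-↑ zero    f = vsym (+v-identityˡ _)
    ∑-↑ (suc m) f = vtrans (+v-congˡ (∑-↑ m (λ i → f (suc i)))) (vsym (+v-assoc _ _ _))

    lincomb-cong : ∀ {d} {c c' : Fin d → Carrier} {b b' : Fin d → V} →
                   (∀ i → c i ≈ c' i) → (∀ i → b i ≈v b' i) → lincomb c b ≈v lincomb c' b'
    lincomb-cong c≈c' b≈b' = ∑-cong (λ i → ·-cong (c≈c' i) (b≈b' i))

    lincomb-closed : ∀ {U} → IsKSubspace U → ∀ {d} {c : Fin d → Carrier} {b : Fin d → V} →
                     (∀ i → K (c i)) → (∀ i → U (b i)) → U (lincomb c b)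
    lincomb-closed U-sub {zero}  c∈K b∈U = IsKSubspace.has0 U-sub
    lincomb-closed U-sub {suc d} c∈K b∈U = IsKSubspace.+-closed U-sub
      (IsKSubspace.·-closed U-sub (c∈K zero) (b∈U zero))
      (lincomb-closed U-sub (λ i → c∈K (suc i)) (λ i → b∈U (suc i)))

    ·-lincomb : ∀ {d} a (c : Fin d → Carrier) (b : Fin d → V) →
                (a ·v lincomb c b) ≈v lincomb (λ i → a * c i) b
    ·-lincomb a c b =
      vtrans (·-distrib-∑ a (λ i → c i ·v b i)) (∑-cong (λ i → vsym (·-assoc a (c i) (b i))))

    lincomb-multiples : ∀ {d} (c μ : Fin d → Carrier) x →
                        lincomb c (λ i → μ i ·v x) ≈v (L1.lincomb c μ ·v x)
    lincomb-multiples c μ x =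
      vtrans (∑-cong (λ i → vsym (·-assoc (c i) (μ i) x))) (vsym (∑-distrib-· (λ i → c i * μ i) x))

    lincomb-lincomb : ∀ {m n} (x : Fin m → Carrier) (M : Fin m → Fin n → Carrier) (b : Fin n → V) →
                      lincomb x (λ j → lincomb (M j) b) ≈v lincomb (λ k → L1.lincomb x (λ j → M j k)) b
    lincomb-lincomb x M b = begin
      ∑ (λ j → x j ·v ∑ (λ k → M j k ·v b k))   ≈⟨ ∑-cong (λ j → ·-lincomb (x j) (M j) b) ⟩
      ∑ (λ j → ∑ (λ k → (x j * M j k) ·v b k))  ≈⟨ ∑-comm (λ j k → (x j * M j k) ·v b k) ⟩
      ∑ (λ k → ∑ (λ j → (x j * M j k) ·v b k))  ≈⟨ ∑-cong (λ k → ∑-distrib-· (λ j → x j * M j k) (b k)) ⟨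
      ∑ (λ k → L1.∑ (λ j → x j * M j k) ·v b k) ∎
      where open ≈v-Reasoning

    lincomb-++ : ∀ {m n} (c : Fin (m ℕ.+ n) → Carrier) (b₁ : Fin m → V) (b₂ : Fin n → V) →
                 lincomb c (b₁ ++ b₂) ≈v (lincomb (λ i → c (i ↑ˡ n)) b₁ +v lincomb (λ j → c (m ↑ʳ j)) b₂)
    lincomb-++ {m} {n} c b₁ b₂ = vtrans (∑-↑ m _) (+v-cong
      (∑-cong (λ i → ·-cong refl (vreflexive (lookup-++ˡ b₁ b₂ i))))
      (∑-cong (λ j → ·-cong refl (vreflexive (lookup-++ʳ b₁ b₂ j)))))

    isolate : ∀ {a a⁻¹ u r} → a⁻¹ * a ≈ 1# → ((a ·v u) +v r) ≈v 0v → u ≈v ((- a⁻¹) ·v r)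
    isolate {a} {a⁻¹} {u} {r} a⁻¹a≈1 au+r≈0 = begin
      u                                            ≈⟨ ·-identity u ⟨
      1# ·v u                                      ≈⟨ ·-cong (sym a⁻¹a≈1) vrefl ⟩
      (a⁻¹ * a) ·v u                               ≈⟨ ·-assoc a⁻¹ a u ⟩
      a⁻¹ ·v (a ·v u)                              ≈⟨ +v-identityʳ _ ⟨
      (a⁻¹ ·v (a ·v u)) +v 0v                      ≈⟨ +v-congˡ (·-zeroˡ r) ⟨
      (a⁻¹ ·v (a ·v u)) +v (0# ·v r)               ≈⟨ +v-congˡ (·-cong (-‿inverseʳ a⁻¹) vrefl) ⟨
      (a⁻¹ ·v (a ·v u)) +v ((a⁻¹ + - a⁻¹) ·v r)    ≈⟨ +v-congˡ (·-distribʳ a⁻¹ (- a⁻¹) r) ⟩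
      (a⁻¹ ·v (a ·v u)) +v ((a⁻¹ ·v r) +v ((- a⁻¹) ·v r)) ≈⟨ +v-assoc _ _ _ ⟨
      ((a⁻¹ ·v (a ·v u)) +v (a⁻¹ ·v r)) +v ((- a⁻¹) ·v r) ≈⟨ +v-congʳ (·-distribˡ a⁻¹ _ r) ⟨
      (a⁻¹ ·v ((a ·v u) +v r)) +v ((- a⁻¹) ·v r)   ≈⟨ +v-congʳ (·-cong refl au+r≈0) ⟩
      (a⁻¹ ·v 0v) +v ((- a⁻¹) ·v r)                ≈⟨ +v-congʳ (·-zeroʳ a⁻¹) ⟩
      0v +v ((- a⁻¹) ·v r)                         ≈⟨ +v-identityˡ _ ⟩
      (- a⁻¹) ·v r                                 ∎
      where open ≈v-Reasoning

  module Dimension (_≟_ : Decidable _≈_) {K : Carrier → Set} (K-subfield : IsSubfield K) where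
    open IsSubfield K-subfield using ()
      renaming ( has0 to K-0; has1 to K-1; +-closed to K-+; neg-closed to K-neg
               ; *-closed to K-*; inv-closed to K-inv )
    module L1 = Lin K L¹
    module C¹ = LinearCombinations K L¹-isVectorStructure

    NontrivialK : ∀ {d} → (Fin d → Carrier) → Set
    NontrivialK x = (∀ j → K (x j)) × ∃ λ j → ¬ x j ≈ 0#

    RowsDependent : ∀ {m n} → (Fin m → Fin n → Carrier) → Set
    RowsDependent v = Σ _ λ x → NontrivialK x × ∀ k → L1.lincomb x (λ j → v j k) ≈ 0#

    K-isSubspace : L1.IsKSubspace K
    K-isSubspace = record
      { resp = IsSubfield.resp K-subfield ; has0 = K-0 ; +-closed = K-+ ; ·-closed = K-* }

    first-row-zero⇒dependent : ∀ {m n} (v : Fin (suc m) → Fin n → Carrier) →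
                               (∀ k → v zero k ≈ 0#) → RowsDependent v
    first-row-zero⇒dependent v v₀≈0 = e₀ , (e₀∈K , zero , λ 1≈0 → 0≉1 (sym 1≈0)) , relation
      where
      e₀ : Fin _ → Carrier
      e₀ = 1# ∷ λ _ → 0#
      e₀∈K : ∀ j → K (e₀ j)
      e₀∈K zero    = K-1
      e₀∈K (suc j) = K-0
      relation : ∀ k → L1.lincomb e₀ (λ j → v j k) ≈ 0#
      relation k = trans (+-cong (trans (*-identityˡ _) (v₀≈0 k)) (C¹.∑-zero (λ j → zeroˡ (v (suc j) k))))
                         (+-identityˡ 0#)

    lincomb-row-operation : ∀ {d} (x a c : Fin d → Carrier) b →
                            L1.lincomb x (λ i → a i + - (c i * b)) ≈ (- L1.lincomb x c) * b + L1.lincomb x a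
    lincomb-row-operation x a c b = begin
      L1.∑ (λ i → x i * (a i + - (c i * b)))
        ≈⟨ C¹.∑-cong (λ i → solve 4 (λ x a c b → x :* (a :+ :- (c :* b)) := x :* a :+ (x :* c) :* (:- b))
                                    refl (x i) (a i) (c i) b) ⟩
      L1.∑ (λ i → x i * a i + (x i * c i) * - b)
        ≈⟨ C¹.∑-distrib-+ (λ i → x i * a i) (λ i → (x i * c i) * - b) ⟩
      L1.lincomb x a + L1.∑ (λ i → (x i * c i) * - b)
        ≈⟨ +-congˡ (C¹.∑-distrib-· (λ i → x i * c i) (- b)) ⟨
      L1.lincomb x a + L1.lincomb x c * - b
        ≈⟨ solve 3 (λ A C b → A :+ C :* (:- b) := (:- C) :* b :+ A) refl _ _ b ⟩
      (- L1.lincomb x c) * b + L1.lincomb x a ∎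
      where open ≈-Reasoning

    -- Gaussian elimination: clear column p of rows 1,…,n+1 with the pivot v₀ₚ and recurse on the
    -- remaining n columns; the relation found among the reduced rows lifts back to v.
    eliminate : ∀ n → (∀ (u : Fin (suc n) → Fin n → Carrier) → (∀ j k → K (u j k)) → RowsDependent u) →
                (v : Fin (suc (suc n)) → Fin (suc n) → Carrier) → (∀ j k → K (v j k)) →
                ∀ p → ¬ v zero p ≈ 0# → RowsDependent v
    eliminate n reduced-dependent v v∈K p vₚ≉0 =
      lift (reduced-dependent (λ j t → w j (punchIn p t))
                              (λ j t → K-+ (v∈K _ _) (K-neg (K-* (c∈K j) (v∈K _ _)))))
      where
      open ≈-Reasoning
      pivot⁻¹ = proj₁ (inverse (v zero p) vₚ≉0)
      pivot-inverse = proj₂ (inverse (v zero p) vₚ≉0)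
      c : Fin (suc n) → Carrier
      c j = v (suc j) p * pivot⁻¹
      c∈K : ∀ j → K (c j)
      c∈K j = K-* (v∈K _ _) (K-inv (v∈K zero p) pivot-inverse)
      w : Fin (suc n) → Fin (suc n) → Carrier
      w j t = v (suc j) t + - (c j * v zero t)
      w-pivot : ∀ j → w j p ≈ 0#
      w-pivot j = begin
        v (suc j) p + - ((v (suc j) p * pivot⁻¹) * v zero p)
          ≈⟨ +-congˡ (-‿cong (solve 3 (λ a i b → (a :* i) :* b := i :* (b :* a)) refl _ pivot⁻¹ _)) ⟩
        v (suc j) p + - (pivot⁻¹ * (v zero p * v (suc j) p))
          ≈⟨ +-congˡ (-‿cong (inverse-cancelˡ pivot-inverse _)) ⟩
        v (suc j) p + - v (suc j) p
          ≈⟨ -‿inverseʳ _ ⟩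
        0# ∎
      lift : RowsDependent (λ j t → w j (punchIn p t)) → RowsDependent v
      lift (x' , (x'∈K , j , x'ⱼ≉0) , x'-relation) = x , (x∈K , suc j , x'ⱼ≉0) , relation
        where
        x : Fin (suc (suc n)) → Carrier
        x = - L1.lincomb x' c ∷ x'
        x∈K : ∀ i → K (x i)
        x∈K zero    = K-neg (C¹.lincomb-closed K-isSubspace x'∈K c∈K)
        x∈K (suc i) = x'∈K i
        x-relation-w : ∀ t → L1.lincomb x (λ i → v i t) ≈ L1.lincomb x' (λ i → w i t)
        x-relation-w t = sym (lincomb-row-operation x' (λ i → v (suc i) t) c (v zero t))
        relation : ∀ t → L1.lincomb x (λ i → v i t) ≈ 0#
        relation t with p Fin.≟ t
        ... | yes ≡.refl = trans (x-relation-w p) (C¹.∑-zero {f = λ i → x' i * w i p}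
                                                    (λ i → trans (*-congˡ (w-pivot i)) (zeroʳ _)))
        ... | no p≢t     = trans (x-relation-w t) (≡.subst (λ t → L1.lincomb x' (λ i → w i t) ≈ 0#)
                             (Fin.punchIn-punchOut p≢t) (x'-relation (punchOut p≢t)))

    more-rows-than-columns⇒dependent : ∀ n (v : Fin (suc n) → Fin n → Carrier) →
                                       (∀ j k → K (v j k)) → RowsDependent v
    more-rows-than-columns⇒dependent zero    v v∈K = first-row-zero⇒dependent v (λ ())
    more-rows-than-columns⇒dependent (suc n) v v∈K with Fin.all? (λ k → v zero k ≟ 0#)
    ... | yes v₀≈0 = first-row-zero⇒dependent v v₀≈0
    ... | no  v₀≉0 with Fin.¬∀⟶∃¬ (suc n) _ (λ k → v zero k ≟ 0#) v₀≉0
    ...   | p , vₚ≉0 = eliminate n (more-rows-than-columns⇒dependent n) v v∈K p vₚ≉0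

    module _ {VS : VecStr} (isVS : IsVectorStructure VS) where
      open VecStr VS
      open IsVectorStructure isVS
      open Lin K VS
      open LinearCombinations K isVS

      Independent : ∀ {d} → (Fin d → V) → Set
      Independent b = ∀ c → (∀ i → K (c i)) → lincomb c b ≈v 0v → ∀ i → c i ≈ 0#

      InSpan : ∀ {d} → (Fin d → V) → V → Set
      InSpan b u = Σ _ λ c → (∀ i → K (c i)) × lincomb c b ≈v u

      span+1⇒dependent : ∀ {n} (b : Fin n → V) (v : Fin (suc n) → V) → (∀ j → InSpan b (v j)) →
                         Σ _ λ x → NontrivialK x × lincomb x v ≈v 0v
      span+1⇒dependent {n} b v v∈span = x , x-nontrivial , (begin
        lincomb x v
          ≈⟨ lincomb-cong {c = x} (λ _ → refl) (λ j → vsym (proj₂ (proj₂ (v∈span j)))) ⟩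
        lincomb x (λ j → lincomb (M j) b)
          ≈⟨ lincomb-lincomb x M b ⟩
        lincomb (λ k → L1.lincomb x (λ j → M j k)) b
          ≈⟨ ∑-zero (λ k → vtrans (·-cong (x-relation k) vrefl) (·-zeroˡ (b k))) ⟩
        0v ∎)
        where
        open ≈v-Reasoning
        M : Fin (suc n) → Fin n → Carrier
        M j = proj₁ (v∈span j)
        x-solution = more-rows-than-columns⇒dependent n M (λ j → proj₁ (proj₂ (v∈span j)))
        x = proj₁ x-solution
        x-nontrivial = proj₁ (proj₂ x-solution)
        x-relation = proj₂ (proj₂ x-solution)

      independent⇒spanning : ∀ {U n} → HasDim U n → (b : Fin n → V) → (∀ i → U (b i)) → Independent b →
                             ∀ {u} → U u → InSpan b u
      independent⇒spanning (e , _ , _ , e-spans) b b∈U b-independent {u} u∈U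
        with span+1⇒dependent e (u ∷ b) (λ { zero → e-spans u u∈U ; (suc i) → e-spans (b i) (b∈U i) })
      ... | x , (x∈K , j , xⱼ≉0) , x-relation with x zero ≟ 0#
      ...   | yes x₀≈0 = ⊥-elim (xⱼ≉0 (x≈0 j))
        where
        rest≈0 : lincomb (λ i → x (suc i)) b ≈v 0v
        rest≈0 = vtrans (vsym (+v-identityˡ _))
                        (vtrans (+v-congʳ (vsym (vtrans (·-cong x₀≈0 vrefl) (·-zeroˡ u)))) x-relation)
        x≈0 : ∀ i → x i ≈ 0#
        x≈0 zero    = x₀≈0
        x≈0 (suc i) = b-independent _ (λ i → x∈K (suc i)) rest≈0 i
      ...   | no x₀≉0 = (λ i → - y * x (suc i)) , (λ i → K-* (K-neg y∈K) (x∈K (suc i))) ,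
                        vsym (vtrans (isolate (trans (*-comm y _) x₀y≈1) x-relation)
                                     (·-lincomb (- y) (λ i → x (suc i)) b))
        where
        y = proj₁ (inverse (x zero) x₀≉0)
        x₀y≈1 = proj₂ (inverse (x zero) x₀≉0)
        y∈K = K-inv (x∈K zero) x₀y≈1

      HasDim-resp : ∀ {U U' n} → U ⊆ U' → U' ⊆ U → HasDim U n → HasDim U' n
      HasDim-resp U⊆U' U'⊆U (b , b∈U , b-independent , b-spans) =
        b , (λ i → U⊆U' (b∈U i)) , b-independent , (λ u u∈U' → b-spans u (U'⊆U u∈U'))

      ⊆∧equal-dim⇒⊇ : ∀ {U U' n} → IsKSubspace U → HasDim U n → HasDim U' n → U ⊆ U' → U' ⊆ U
      ⊆∧equal-dim⇒⊇ U-sub (b , b∈U , b-independent , _) U'-dim U⊆U' u∈U'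
        with independent⇒spanning U'-dim b (λ i → U⊆U' (b∈U i)) b-independent u∈U'
      ... | c , c∈K , cb≈u = IsKSubspace.resp U-sub cb≈u (lincomb-closed U-sub c∈K b∈U)

      direct-sum : ∀ {U U₁ U₂ m n} → IsKSubspace U₁ → IsKSubspace U₂ → U₁ ⊆ U → U₂ ⊆ U →
                   HasDim U₁ m → HasDim U₂ n → HasDim U (m ℕ.+ n) →
                   (∀ {u₁ u₂} → U₁ u₁ → U₂ u₂ → (u₁ +v u₂) ≈v 0v → u₁ ≈v 0v × u₂ ≈v 0v) →
                   ∀ {u} → U u → Σ V λ u₁ → Σ V λ u₂ → U₁ u₁ × U₂ u₂ × (u₁ +v u₂) ≈v u
      direct-sum {U} {U₁} {U₂} {m} {n} U₁-sub U₂-sub U₁⊆U U₂⊆U (b₁ , b₁∈U₁ , b₁-independent , _)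
                 (b₂ , b₂∈U₂ , b₂-independent , _) U-dim trivial-intersection {u} u∈U =
        split (independent⇒spanning U-dim (b₁ ++ b₂) b∈U b-independent u∈U)
        where
        b∈U : ∀ k → U ((b₁ ++ b₂) k)
        b∈U k with splitAt m k
        ... | inj₁ i = U₁⊆U (b₁∈U₁ i)
        ... | inj₂ j = U₂⊆U (b₂∈U₂ j)
        parts : ∀ {c} → (∀ k → K (c k)) →
                U₁ (lincomb (λ i → c (i ↑ˡ n)) b₁) × U₂ (lincomb (λ j → c (m ↑ʳ j)) b₂)
        parts c∈K = lincomb-closed U₁-sub (λ i → c∈K (i ↑ˡ n)) b₁∈U₁ ,
                    lincomb-closed U₂-sub (λ j → c∈K (m ↑ʳ j)) b₂∈U₂
        b-independent : Independent (b₁ ++ b₂)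
        b-independent c c∈K cb≈0 = ↑-elim (λ k → c k ≈ 0#)
          (b₁-independent _ (λ i → c∈K (i ↑ˡ n)) (proj₁ parts≈0))
          (b₂-independent _ (λ j → c∈K (m ↑ʳ j)) (proj₂ parts≈0))
          where
          parts≈0 = trivial-intersection (proj₁ (parts {c} c∈K)) (proj₂ (parts {c} c∈K))
                                         (vtrans (vsym (lincomb-++ c b₁ b₂)) cb≈0)
        split : InSpan (b₁ ++ b₂) u → Σ V λ u₁ → Σ V λ u₂ → U₁ u₁ × U₂ u₂ × (u₁ +v u₂) ≈v u
        split (c , c∈K , cb≈u) =
          _ , _ , proj₁ (parts {c} c∈K) , proj₂ (parts {c} c∈K) , vtrans (vsym (lincomb-++ c b₁ b₂)) cb≈u

  rows : L2 → L2 → Mat2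
  rows (a , b) (c , d) = mat a b c d

  det : Mat2 → Carrier
  det (mat a b c d) = a * d + - (b * c)

  scaled-adjugate : Mat2 → Carrier → Mat2
  scaled-adjugate (mat a b c d) δ = mat (d * δ) (- (b * δ)) (- (c * δ)) (a * δ)

  ∙M-assoc : ∀ u X Y → ((u ∙M X) ∙M Y) ≈₂ (u ∙M (X ⊗ Y))
  ∙M-assoc (x , y) (mat a b c d) (mat a' b' c' d') =
    solve 8 (λ x y a b c d a' c' → (x :* a :+ y :* c) :* a' :+ (x :* b :+ y :* d) :* c'
                                := x :* (a :* a' :+ b :* c') :+ y :* (c :* a' :+ d :* c')) refl x y a b c d a' c' ,
    solve 8 (λ x y a b c d b' d' → (x :* a :+ y :* c) :* b' :+ (x :* b :+ y :* d) :* d'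
                                := x :* (a :* b' :+ b :* d') :+ y :* (c :* b' :+ d :* d')) refl x y a b c d b' d'

  ∙M-identity : ∀ u → (u ∙M I₂) ≈₂ u
  ∙M-identity (x , y) = solve 2 (λ x y → x :* con (+ 1) :+ y :* con (+ 0) := x) refl x y ,
                        solve 2 (λ x y → x :* con (+ 0) :+ y :* con (+ 1) := y) refl x y

  ∙M-congˡ : ∀ {u u'} X → u ≈₂ u' → (u ∙M X) ≈₂ (u' ∙M X)
  ∙M-congˡ (mat a b c d) (x≈x' , y≈y') =
    +-cong (*-congʳ x≈x') (*-congʳ y≈y') , +-cong (*-congʳ x≈x') (*-congʳ y≈y')

  ∙M-congʳ : ∀ u {X Y} → X ≈M Y → (u ∙M X) ≈₂ (u ∙M Y)
  ∙M-congʳ (x , y) {mat _ _ _ _} {mat _ _ _ _} (a≈a' , b≈b' , c≈c' , d≈d') =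
    +-cong (*-congˡ a≈a') (*-congˡ c≈c') , +-cong (*-congˡ b≈b') (*-congˡ d≈d')

  ∙M-cancel : ∀ {X Y} → (X ⊗ Y) ≈M I₂ → ∀ u → ((u ∙M X) ∙M Y) ≈₂ u
  ∙M-cancel {X} {Y} XY≈I u = ≈₂-trans (∙M-assoc u X Y) (≈₂-trans (∙M-congʳ u XY≈I) (∙M-identity u))

  ∙M-injective : ∀ {X Y u u'} → (X ⊗ Y) ≈M I₂ → (u ∙M X) ≈₂ (u' ∙M X) → u ≈₂ u'
  ∙M-injective {X} {Y} {u} {u'} XY≈I uX≈u'X =
    ≈₂-trans (≈₂-sym (∙M-cancel XY≈I u)) (≈₂-trans (∙M-congˡ Y uX≈u'X) (∙M-cancel XY≈I u'))

  scaled-adjugate-inverse : ∀ X {δ} → det X * δ ≈ 1# →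
                            (X ⊗ scaled-adjugate X δ) ≈M I₂ × (scaled-adjugate X δ ⊗ X) ≈M I₂
  scaled-adjugate-inverse (mat a b c d) {δ} detδ≈1 =
    ( trans (solve 5 (λ a b c d δ → a :* (d :* δ) :+ b :* (:- (c :* δ)) := D a b c d :* δ)
                     refl a b c d δ) detδ≈1
    , solve 5 (λ a b c d δ → a :* (:- (b :* δ)) :+ b :* (a :* δ) := con (+ 0)) refl a b c d δ
    , solve 5 (λ a b c d δ → c :* (d :* δ) :+ d :* (:- (c :* δ)) := con (+ 0)) refl a b c d δ
    , trans (solve 5 (λ a b c d δ → c :* (:- (b :* δ)) :+ d :* (a :* δ) := D a b c d :* δ)
                     refl a b c d δ) detδ≈1 ) ,
    ( trans (solve 5 (λ a b c d δ → (d :* δ) :* a :+ (:- (b :* δ)) :* c := D a b c d :* δ)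
                     refl a b c d δ) detδ≈1
    , solve 5 (λ a b c d δ → (d :* δ) :* b :+ (:- (b :* δ)) :* d := con (+ 0)) refl a b c d δ
    , solve 5 (λ a b c d δ → (:- (c :* δ)) :* a :+ (a :* δ) :* c := con (+ 0)) refl a b c d δ
    , trans (solve 5 (λ a b c d δ → (:- (c :* δ)) :* b :+ (a :* δ) :* d := D a b c d :* δ)
                     refl a b c d δ) detδ≈1 )
    where D = λ a b c d → a :* d :+ :- (b :* c)

  det-rows-· : ∀ a b u v → det (rows (a ·₂ u) (b ·₂ v)) ≈ (a * b) * det (rows u v)
  det-rows-· a b (u₁ , u₂) (v₁ , v₂) =
    solve 6 (λ a b u₁ u₂ v₁ v₂ → (a :* u₁) :* (b :* v₂) :+ :- ((a :* u₂) :* (b :* v₁))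
                              := (a :* b) :* (u₁ :* v₂ :+ :- (u₂ :* v₁))) refl a b u₁ u₂ v₁ v₂

  proportional-by-pivot : ∀ {p p' r r'} → ¬ p ≈ 0# → p * r' ≈ p' * r →
                          Σ Carrier λ t → (r ≈ t * p) × (r' ≈ t * p')
  proportional-by-pivot {p} {p'} {r} {r'} p≉0 pr'≈p'r with inverse p p≉0
  ... | p⁻¹ , pp⁻¹≈1 = r * p⁻¹ , sym r≈ , sym r'≈
    where
    open ≈-Reasoning
    r≈ : (r * p⁻¹) * p ≈ r
    r≈ = trans (solve 3 (λ r p⁻¹ p → (r :* p⁻¹) :* p := p⁻¹ :* (p :* r)) refl r p⁻¹ p)
               (inverse-cancelˡ pp⁻¹≈1 r)
    r'≈ : (r * p⁻¹) * p' ≈ r'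
    r'≈ = begin
      (r * p⁻¹) * p'   ≈⟨ solve 3 (λ r p⁻¹ p' → (r :* p⁻¹) :* p' := p⁻¹ :* (p' :* r)) refl r p⁻¹ p' ⟩
      p⁻¹ * (p' * r)   ≈⟨ *-congˡ pr'≈p'r ⟨
      p⁻¹ * (p * r')   ≈⟨ inverse-cancelˡ pp⁻¹≈1 r' ⟩
      r'               ∎

  difference≈0⇒≈ : ∀ {a b} → a + - b ≈ 0# → a ≈ b
  difference≈0⇒≈ {a} {b} a-b≈0 = begin
    a              ≈⟨ solve 2 (λ a b → a := (a :+ :- b) :+ b) refl a b ⟩
    (a + - b) + b  ≈⟨ +-congʳ a-b≈0 ⟩
    0# + b         ≈⟨ +-identityˡ b ⟩
    b              ∎
    where open ≈-Reasoning

  det≈0⇒Proportional : Decidable _≈_ → ∀ y z → det (rows y z) ≈ 0# → Proportional y z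
  det≈0⇒Proportional _≟_ (y₁ , y₂) (z₁ , z₂) det≈0 = by-cases (y₁ ≟ 0#) (y₂ ≟ 0#)
    where
    cross : y₁ * z₂ ≈ y₂ * z₁
    cross = difference≈0⇒≈ det≈0
    by-cases : Dec (y₁ ≈ 0#) → Dec (y₂ ≈ 0#) → Proportional (y₁ , y₂) (z₁ , z₂)
    by-cases (no y₁≉0) _          = inj₁ (proportional-by-pivot y₁≉0 cross)
    by-cases (yes _)   (no y₂≉0)  with proportional-by-pivot y₂≉0 (sym cross)
    ... | t , z₂≈ , z₁≈ = inj₁ (t , z₁≈ , z₂≈)
    by-cases (yes y₁≈0) (yes y₂≈0) = inj₂ (0# , trans y₁≈0 (sym (zeroˡ z₁)) , trans y₂≈0 (sym (zeroˡ z₂)))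

  ≈₂⇒∈⟨⟩ : ∀ {u v} → u ≈₂ v → ⟨ u ⟩ v
  ≈₂⇒∈⟨⟩ u≈v = 1# , ≈₂-trans (≈₂-sym u≈v) (≈₂-sym (·₂-identity _))

  ⟨⟩-⊆ : ∀ {g y} → ⟨ g ⟩ y → ⟨ y ⟩ ⊆ ⟨ g ⟩
  ⟨⟩-⊆ {g} (κ , y≈κg) (λ' , w≈λ'y) =
    λ' * κ , ≈₂-trans w≈λ'y (≈₂-trans (·₂-cong refl y≈κg) (≈₂-sym (·₂-assoc λ' κ g)))

  ∈⟨·⟩ : ∀ {a} y → ¬ a ≈ 0# → ⟨ a ·₂ y ⟩ y
  ∈⟨·⟩ {a} (y₁ , y₂) a≉0 with inverse a a≉0
  ... | a⁻¹ , aa⁻¹≈1 = a⁻¹ , sym (inverse-cancelˡ aa⁻¹≈1 y₁) , sym (inverse-cancelˡ aa⁻¹≈1 y₂)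

  -- In the coordinates given by the rows g₁, g₂ of B⁻¹ the lines ⟨y₁⟩, ⟨y₂⟩, ⟨y₃⟩ become
  -- the two axes and the diagonal.
  record Frame (y₁ y₂ y₃ : L2) : Set where
    field
      g₁ g₂     : L2
      g₁∈⟨y₁⟩   : ⟨ y₁ ⟩ g₁
      y₁∈⟨g₁⟩   : ⟨ g₁ ⟩ y₁
      g₂∈⟨y₂⟩   : ⟨ y₂ ⟩ g₂
      y₂∈⟨g₂⟩   : ⟨ g₂ ⟩ y₂
      g₁+g₂≈y₃  : (g₁ +₂ g₂) ≈₂ y₃
      B         : Mat2
      rows-B≈I  : (rows g₁ g₂ ⊗ B) ≈M I₂
      B-rows≈I  : (B ⊗ rows g₁ g₂) ≈M I₂

    g₁+g₂∈⟨y₃⟩ : ⟨ y₃ ⟩ (g₁ +₂ g₂)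
    g₁+g₂∈⟨y₃⟩ = ≈₂⇒∈⟨⟩ (≈₂-sym g₁+g₂≈y₃)

    y₃∈⟨g₁+g₂⟩ : ⟨ g₁ +₂ g₂ ⟩ y₃
    y₃∈⟨g₁+g₂⟩ = ≈₂⇒∈⟨⟩ g₁+g₂≈y₃

  frame : Decidable _≈_ → ∀ {y₁ y₂ y₃} →
          ¬ Proportional y₁ y₂ → ¬ Proportional y₁ y₃ → ¬ Proportional y₂ y₃ → Frame y₁ y₂ y₃
  frame _≟_ {y₁} {y₂} {y₃} ¬y₁∥y₂ ¬y₁∥y₃ ¬y₂∥y₃ = record
    { g₁ = a ·₂ y₁ ; g₂ = b ·₂ y₂
    ; g₁∈⟨y₁⟩ = a , ≈₂-refl ; y₁∈⟨g₁⟩ = ∈⟨·⟩ y₁ a≉0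
    ; g₂∈⟨y₂⟩ = b , ≈₂-refl ; y₂∈⟨g₂⟩ = ∈⟨·⟩ y₂ b≉0
    ; g₁+g₂≈y₃ = y₃-coordinates
    ; B = scaled-adjugate (rows (a ·₂ y₁) (b ·₂ y₂)) ε
    ; rows-B≈I = proj₁ (scaled-adjugate-inverse _ detε≈1)
    ; B-rows≈I = proj₂ (scaled-adjugate-inverse _ detε≈1) }
    where
    Y = rows y₁ y₂
    detY≉0 : ¬ det Y ≈ 0#
    detY≉0 detY≈0 = ¬y₁∥y₂ (det≈0⇒Proportional _≟_ y₁ y₂ detY≈0)
    δ = proj₁ (inverse (det Y) detY≉0)
    detYδ≈1 = proj₂ (inverse (det Y) detY≉0)
    a = proj₁ (y₃ ∙M scaled-adjugate Y δ)
    b = proj₂ (y₃ ∙M scaled-adjugate Y δ)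
    y₃-coordinates : ((a ·₂ y₁) +₂ (b ·₂ y₂)) ≈₂ y₃
    y₃-coordinates = ∙M-cancel (proj₂ (scaled-adjugate-inverse Y detYδ≈1)) y₃
    a≉0 : ¬ a ≈ 0#
    a≉0 a≈0 = ¬y₂∥y₃ (inj₁ (b , ≈₂-trans (≈₂-sym y₃-coordinates)
      (≈₂-trans (+₂-congʳ (≈₂-trans (·₂-cong a≈0 ≈₂-refl) (·₂-zeroˡ y₁))) (+₂-identityˡ _))))
    b≉0 : ¬ b ≈ 0#
    b≉0 b≈0 = ¬y₁∥y₃ (inj₁ (a , ≈₂-trans (≈₂-sym y₃-coordinates)
      (≈₂-trans (+₂-congˡ (≈₂-trans (·₂-cong b≈0 ≈₂-refl) (·₂-zeroˡ y₂))) (+₂-identityʳ _))))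
    det≉0 : ¬ det (rows (a ·₂ y₁) (b ·₂ y₂)) ≈ 0#
    det≉0 det≈0 = *-nonzero (*-nonzero a≉0 b≉0) detY≉0 (trans (sym (det-rows-· a b y₁ y₂)) det≈0)
    ε = proj₁ (inverse _ det≉0)
    detε≈1 = proj₂ (inverse _ det≉0)

  module Slices (_≟_ : Decidable _≈_) {K : Carrier → Set} (K-subfield : IsSubfield K)
                {W : L2 → Set} (W-subspace : Lin.IsKSubspace K L² W) where
    open Dimension _≟_ K-subfield
    module Lin² = Lin K L²
    module C² = LinearCombinations K L²-isVectorStructure
    open Lin.IsKSubspace W-subspace renaming (resp to W-resp; has0 to W-0; +-closed to W-+; ·-closed to W-·)

    Coeffs : L2 → Carrier → Set
    Coeffs g x = W (x ·₂ g)

    Coeffs-isSubspace : ∀ g → L1.IsKSubspace (Coeffs g)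
    Coeffs-isSubspace g = record
      { resp     = λ x≈y → W-resp (·₂-cong x≈y ≈₂-refl)
      ; has0     = W-resp (≈₂-sym (·₂-zeroˡ g)) W-0
      ; +-closed = λ x∈S y∈S → W-resp (≈₂-sym (·₂-distribʳ _ _ g)) (W-+ x∈S y∈S)
      ; ·-closed = λ a∈K x∈S → W-resp (≈₂-sym (·₂-assoc _ _ g)) (W-· a∈K x∈S) }

    W∩⟨⟩-isSubspace : ∀ g → Lin².IsKSubspace (W ∩ ⟨ g ⟩)
    W∩⟨⟩-isSubspace g = record
      { resp     = λ u≈v (u∈W , λ' , u≈λ'g) → W-resp u≈v u∈W , λ' , ≈₂-trans (≈₂-sym u≈v) u≈λ'g
      ; has0     = W-0 , 0# , ≈₂-sym (·₂-zeroˡ g)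
      ; +-closed = λ (u∈W , λ' , u≈) (v∈W , μ , v≈) →
                     W-+ u∈W v∈W , λ' + μ , ≈₂-trans (+₂-cong u≈ v≈) (≈₂-sym (·₂-distribʳ λ' μ g))
      ; ·-closed = λ {a} a∈K (u∈W , λ' , u≈) →
                     W-· a∈K u∈W , a * λ' , ≈₂-trans (·₂-cong refl u≈) (≈₂-sym (·₂-assoc a λ' g)) }

    W∩⟨⟩-dim-resp : ∀ {y g n} → ⟨ y ⟩ g → ⟨ g ⟩ y → Lin².HasDim (W ∩ ⟨ y ⟩) n → Lin².HasDim (W ∩ ⟨ g ⟩) n
    W∩⟨⟩-dim-resp g∈⟨y⟩ y∈⟨g⟩ = HasDim-resp L²-isVectorStructure
      (λ (w∈W , w∈⟨y⟩) → w∈W , ⟨⟩-⊆ y∈⟨g⟩ w∈⟨y⟩) (λ (w∈W , w∈⟨g⟩) → w∈W , ⟨⟩-⊆ g∈⟨y⟩ w∈⟨g⟩)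

    Coeffs-dim : ∀ {g n} → (∀ {x x'} → (x ·₂ g) ≈₂ (x' ·₂ g) → x ≈ x') →
                 Lin².HasDim (W ∩ ⟨ g ⟩) n → L1.HasDim (Coeffs g) n
    Coeffs-dim {g} ·g-injective (u , u∈W∩⟨g⟩ , u-independent , u-spans) = μ , μ∈S , μ-independent , μ-spans
      where
      μ = λ i → proj₁ (proj₂ (u∈W∩⟨g⟩ i))
      u≈μg = λ i → proj₂ (proj₂ (u∈W∩⟨g⟩ i))
      μ∈S = λ i → W-resp (u≈μg i) (proj₁ (u∈W∩⟨g⟩ i))
      lincomb-u : ∀ c → Lin².lincomb c u ≈₂ (L1.lincomb c μ ·₂ g)
      lincomb-u c = ≈₂-trans (C².lincomb-cong {c = c} (λ _ → refl) u≈μg) (C².lincomb-multiples c μ g)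
      μ-independent : Independent L¹-isVectorStructure μ
      μ-independent c c∈K cμ≈0 =
        u-independent c c∈K (≈₂-trans (lincomb-u c) (≈₂-trans (·₂-cong cμ≈0 ≈₂-refl) (·₂-zeroˡ g)))
      μ-spans : ∀ x → Coeffs g x → InSpan L¹-isVectorStructure μ x
      μ-spans x x∈S with u-spans (x ·₂ g) (x∈S , x , ≈₂-refl)
      ... | c , c∈K , cu≈xg = c , c∈K , ·g-injective (≈₂-trans (≈₂-sym (lincomb-u c)) cu≈xg)

    module Axes {g₁ g₂ : L2} {B : Mat2} (ZB≈I : (rows g₁ g₂ ⊗ B) ≈M I₂) (BZ≈I : (B ⊗ rows g₁ g₂) ≈M I₂)
                {l} (W-dim : Lin².HasDim W (l ℕ.+ l))
                (dim₁ : Lin².HasDim (W ∩ ⟨ g₁ ⟩) l) (dim₂ : Lin².HasDim (W ∩ ⟨ g₂ ⟩) l)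
                (dim₃ : Lin².HasDim (W ∩ ⟨ g₁ +₂ g₂ ⟩) l) where
      Z : Mat2
      Z = rows g₁ g₂

      axis₁ : ∀ x → ((x , 0#) ∙M Z) ≈₂ (x ·₂ g₁)
      axis₁ x = ≈₂-trans (+₂-congˡ (·₂-zeroˡ g₂)) (+₂-identityʳ _)

      axis₂ : ∀ x → ((0# , x) ∙M Z) ≈₂ (x ·₂ g₂)
      axis₂ x = ≈₂-trans (+₂-congʳ (·₂-zeroˡ g₁)) (+₂-identityˡ _)

      diagonal : ∀ x → ((x , x) ∙M Z) ≈₂ (x ·₂ (g₁ +₂ g₂))
      diagonal x = ≈₂-sym (·₂-distribˡ x g₁ g₂)

      ·-injective : ∀ {g} (e : Carrier → L2) → (∀ x → (e x ∙M Z) ≈₂ (x ·₂ g)) →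
                    (∀ {x x'} → e x ≈₂ e x' → x ≈ x') → ∀ {x x'} → (x ·₂ g) ≈₂ (x' ·₂ g) → x ≈ x'
      ·-injective e eZ≈ e-injective xg≈x'g =
        e-injective (∙M-injective ZB≈I (≈₂-trans (eZ≈ _) (≈₂-trans xg≈x'g (≈₂-sym (eZ≈ _)))))

      axis₁-dim : L1.HasDim (Coeffs g₁) l
      axis₁-dim = Coeffs-dim (·-injective (λ x → x , 0#) axis₁ proj₁) dim₁

      axis₂-dim : L1.HasDim (Coeffs g₂) l
      axis₂-dim = Coeffs-dim (·-injective (λ x → 0# , x) axis₂ proj₂) dim₂

      diagonal-dim : L1.HasDim (Coeffs (g₁ +₂ g₂)) l
      diagonal-dim = Coeffs-dim (·-injective (λ x → x , x) diagonal proj₁) dim₃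

      axes-independent : ∀ {u₁ u₂} → (W ∩ ⟨ g₁ ⟩) u₁ → (W ∩ ⟨ g₂ ⟩) u₂ →
                         (u₁ +₂ u₂) ≈₂ (0# , 0#) → u₁ ≈₂ (0# , 0#) × u₂ ≈₂ (0# , 0#)
      axes-independent (_ , λ₁ , u₁≈) (_ , λ₂ , u₂≈) u₁+u₂≈0 =
        ≈₂-trans u₁≈ (≈₂-trans (·₂-cong (proj₁ λ≈0) ≈₂-refl) (·₂-zeroˡ g₁)) ,
        ≈₂-trans u₂≈ (≈₂-trans (·₂-cong (proj₂ λ≈0) ≈₂-refl) (·₂-zeroˡ g₂))
        where
        λ≈0 : (λ₁ , λ₂) ≈₂ (0# , 0#)
        λ≈0 = ∙M-injective ZB≈I (≈₂-trans (≈₂-sym (+₂-cong u₁≈ u₂≈))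
                (≈₂-trans u₁+u₂≈0 (≈₂-sym (≈₂-trans (axis₁ 0#) (·₂-zeroˡ g₁)))))

      W-split : ∀ {w} → W w → Σ L2 λ u₁ → Σ L2 λ u₂ → (W ∩ ⟨ g₁ ⟩) u₁ × (W ∩ ⟨ g₂ ⟩) u₂ × (u₁ +₂ u₂) ≈₂ w
      W-split = direct-sum L²-isVectorStructure (W∩⟨⟩-isSubspace g₁) (W∩⟨⟩-isSubspace g₂) proj₁ proj₁
                           dim₁ dim₂ W-dim axes-independent

      -- Stated on its own because inferring the implicit arguments of ∙M-injective at the use site
      -- makes type checking blow up.
      coordinates-unique : ∀ {λ₁ λ₂ x₁ x₂} → ((λ₁ ·₂ g₁) +₂ (λ₂ ·₂ g₂)) ≈₂ ((x₁ , x₂) ∙M Z) →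
                           (λ₁ , λ₂) ≈₂ (x₁ , x₂)
      coordinates-unique = ∙M-injective ZB≈I

      decompose : ∀ {x₁ x₂} → W ((x₁ , x₂) ∙M Z) → Coeffs g₁ x₁ × Coeffs g₂ x₂
      decompose {x₁} {x₂} x∈W = from-split (W-split x∈W)
        where
        from-split : (Σ L2 λ u₁ → Σ L2 λ u₂ → (W ∩ ⟨ g₁ ⟩) u₁ × (W ∩ ⟨ g₂ ⟩) u₂ ×
                                                (u₁ +₂ u₂) ≈₂ ((x₁ , x₂) ∙M Z)) →
                     Coeffs g₁ x₁ × Coeffs g₂ x₂
        from-split (u₁ , u₂ , (u₁∈W , λ₁ , u₁≈) , (u₂∈W , λ₂ , u₂≈) , u₁+u₂≈x) =
          W-resp (≈₂-trans u₁≈ (·₂-cong (proj₁ λ≈x) ≈₂-refl)) u₁∈W ,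
          W-resp (≈₂-trans u₂≈ (·₂-cong (proj₂ λ≈x) ≈₂-refl)) u₂∈W
          where
          λ≈x : (λ₁ , λ₂) ≈₂ (x₁ , x₂)
          λ≈x = coordinates-unique (≈₂-trans (≈₂-sym (+₂-cong u₁≈ u₂≈)) u₁+u₂≈x)

      diagonal⊆axes : Coeffs (g₁ +₂ g₂) ⊆ Coeffs g₁ ∩ Coeffs g₂
      diagonal⊆axes x∈S₃ = decompose (W-resp (≈₂-sym (diagonal _)) x∈S₃)

      axis₁⊆diagonal : Coeffs g₁ ⊆ Coeffs (g₁ +₂ g₂)
      axis₁⊆diagonal = ⊆∧equal-dim⇒⊇ L¹-isVectorStructure (Coeffs-isSubspace _) diagonal-dim axis₁-dim
                                     (λ x∈S₃ → proj₁ (diagonal⊆axes x∈S₃))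

      axis₂⊆diagonal : Coeffs g₂ ⊆ Coeffs (g₁ +₂ g₂)
      axis₂⊆diagonal = ⊆∧equal-dim⇒⊇ L¹-isVectorStructure (Coeffs-isSubspace _) diagonal-dim axis₂-dim
                                     (λ x∈S₃ → proj₂ (diagonal⊆axes x∈S₃))

      B-invertible : InGL2 B
      B-invertible = Z , BZ≈I , ZB≈I

      W·B≈S×S : ImageEq W B (Coeffs g₁)
      W·B≈S×S z = image⊆S×S , S×S⊆image
        where
        image⊆S×S : (Σ L2 λ w → W w × (w ∙M B) ≈₂ z) → Coeffs g₁ (proj₁ z) × Coeffs g₁ (proj₂ z)
        image⊆S×S (w , w∈W , wB≈z) = proj₁ z∈S₁×S₂ , proj₁ (diagonal⊆axes (axis₂⊆diagonal (proj₂ z∈S₁×S₂)))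
          where
          w≈zZ : w ≈₂ (z ∙M Z)
          w≈zZ = ≈₂-trans (≈₂-sym (∙M-cancel BZ≈I w)) (∙M-congˡ Z wB≈z)
          z∈S₁×S₂ : Coeffs g₁ (proj₁ z) × Coeffs g₂ (proj₂ z)
          z∈S₁×S₂ = decompose {proj₁ z} {proj₂ z} (W-resp w≈zZ w∈W)
        S×S⊆image : Coeffs g₁ (proj₁ z) × Coeffs g₁ (proj₂ z) → Σ L2 λ w → W w × (w ∙M B) ≈₂ z
        S×S⊆image (z₁∈S₁ , z₂∈S₁) =
          z ∙M Z , W-+ z₁∈S₁ (proj₂ (diagonal⊆axes (axis₁⊆diagonal z₂∈S₁))) , ∙M-cancel ZB≈I z

proposition5p2 : (F : Field) → let open FieldTheory F in
    (K : Carrier → Set) → IsSubfield K →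
    (q m l : ℕ) → IsPrimePower q → m ≥ 1 → l ≥ 1 →
    HasCardSub K q → HasCard (q ^ m) →
    (W : L2 → Set) → Lin.IsKSubspace K L² W → Lin.HasDim K L² W (2 *ℕ l) →
    (y₁ y₂ y₃ : L2) → W y₁ → W y₂ → W y₃ →
    ¬ Proportional y₁ y₂ → ¬ Proportional y₁ y₃ → ¬ Proportional y₂ y₃ →
    Lin.HasDim K L² (λ w → W w × ⟨ y₁ ⟩ w) l →
    Lin.HasDim K L² (λ w → W w × ⟨ y₂ ⟩ w) l →
    Lin.HasDim K L² (λ w → W w × ⟨ y₃ ⟩ w) l →
    Σ (Carrier → Set) λ S →
    Lin.IsKSubspace K L¹ S × Lin.HasDim K L¹ S l ×
    Σ Mat2 λ B → InGL2 B × ImageEq W B S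
proposition5p2 F K K-subfield q m l _ _ _ _ L-finite W W-subspace W-dim y₁ y₂ y₃ _ _ _
               ¬y₁∥y₂ ¬y₁∥y₃ ¬y₂∥y₃ dim₁ dim₂ dim₃ =
  Coeffs g₁ , Coeffs-isSubspace g₁ , axis₁-dim , B , B-invertible , W·B≈S×S
  where
  _≟_ = finite⇒decidable F L-finite
  open Frame (frame F _≟_ ¬y₁∥y₂ ¬y₁∥y₃ ¬y₂∥y₃)
  open Slices F _≟_ K-subfield W-subspace
  open Axes rows-B≈I B-rows≈I (≡.subst (Lin².HasDim W) (≡.cong (l ℕ.+_) (ℕ.+-identityʳ l)) W-dim)
    (W∩⟨⟩-dim-resp g₁∈⟨y₁⟩ y₁∈⟨g₁⟩ dim₁) (W∩⟨⟩-dim-resp g₂∈⟨y₂⟩ y₂∈⟨g₂⟩ dim₂)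
    (W∩⟨⟩-dim-resp g₁+g₂∈⟨y₃⟩ y₃∈⟨g₁+g₂⟩ dim₃)
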